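{- Let $q>7$ be a prime and $k$ a positive integer. Then the number of primes in the set $\{2q+1,4q+1,\dots,2qk+1\}$ is at most $\lfloor k/2\rfloor+1$. Moreover, equality occurs for $k=4$ and $q=11$. -}

module Defs where

open import Data.Nat using (ℕ; suc; _+_; _*_)
open import Data.List using (List; applyUpTo; filter; length)
open import Data.Nat.Primality using (prime?)

-- The list [2q·1+1, 2q·2+1, …, 2q·k+1] (elements are pairwise distinct for q > 0,
-- so it represents the set {2q+1, 4q+1, …, 2qk+1}).
progression : ℕ → ℕ → List ℕ
progression q k = applyUpTo (λ i → 2 * q * suc i + 1) k

primeCount : ℕ → ℕ → ℕ
primeCount q k = length (filter prime? (progression q k))

-- A prime term 2qi + 1 > 7 is divisible by none of 3, 5, 7. Whether a term avoids 3, 5 and 7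
-- depends only on q and i modulo 105, and for q coprime to 105 each of 3, 5, 7 removes exactly
-- one residue class of i, so only 2·4·6 = 48 of every 105 consecutive terms survive. As
-- 48 < 105 / 2, the bound follows from a finite check over one period for each admissible q mod 105.
module Submission where

open import Defs
open import Data.Nat using (ℕ; _<_; _≤_; _/_; _+_)
open import Data.Nat.Primality using (Prime)
open import Data.Product using (_×_)
open import Relation.Binary.PropositionalEquality using (_≡_)

open import Level using (Level)
open import Data.Bool using (true; false; if_then_else_)
open import Data.List using (applyUpTo; filter; length)
open import Data.Nat using (zero; suc; _*_; _%_; NonZero; NonTrivial; z≤n; s≤s)
open import Data.Nat.Properties
open import Data.Nat.DivMod using (m≡m%n+[m/n]*n; m%n<n; m*n/n≡m; +-distrib-/-∣ˡ; /-monoˡ-≤)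
open import Data.Nat.Divisibility using (_∣_; _∣?_; divides; ∣-trans; n∣m*n; ∣m∣n⇒∣m+n; ∣m+n∣m⇒∣n)
open import Data.Nat.Primality using (prime?; composite)
open import Data.Product using (_,_)
open import Data.Product.Function.NonDependent.Propositional using (_×-⇔_)
open import Function using (_∘_; _⇔_; mk⇔; Equivalence)
open import Relation.Nullary using (¬_; ¬?; does; yes; no; contradiction)
open import Relation.Nullary.Decidable using (_×-dec_; _→-dec_; does-⇔; toWitness)
open import Relation.Unary using (Pred; Decidable)
open import Relation.Binary.PropositionalEquality using (refl; sym; trans; cong; subst; module ≡-Reasoning)
open import Data.Nat.Tactic.RingSolver using (solve-∀)

private variable
  ℓ ℓ′ : Level
  P : Pred ℕ ℓ
  Q : Pred ℕ ℓ′

count : Decidable P → ℕ → ℕ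
count P? zero    = 0
count P? (suc k) = if does (P? 0) then suc (count (P? ∘ suc) k) else count (P? ∘ suc) k

count-cong : (P? : Decidable P) (Q? : Decidable Q) → (∀ i → P i ⇔ Q i) →
             ∀ k → count P? k ≡ count Q? k
count-cong P? Q? P⇔Q zero    = refl
count-cong P? Q? P⇔Q (suc k)
  rewrite does-⇔ (P⇔Q 0) (P? 0) (Q? 0)
        | count-cong (P? ∘ suc) (Q? ∘ suc) (P⇔Q ∘ suc) k = refl

count-mono : (P? : Decidable P) (Q? : Decidable Q) → (∀ {i} → P i → Q i) →
             ∀ k → count P? k ≤ count Q? k
count-mono P? Q? P⇒Q zero = z≤n
count-mono P? Q? P⇒Q (suc k) with P? 0 | Q? 0
... | yes _ | yes _  = s≤s (count-mono (P? ∘ suc) (Q? ∘ suc) P⇒Q k)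
... | yes p | no ¬q  = contradiction (P⇒Q p) ¬q
... | no _  | yes _  = m≤n⇒m≤1+n (count-mono (P? ∘ suc) (Q? ∘ suc) P⇒Q k)
... | no _  | no _   = count-mono (P? ∘ suc) (Q? ∘ suc) P⇒Q k

count-+ : (P? : Decidable P) → ∀ m n → count P? (m + n) ≡ count P? m + count (P? ∘ (m +_)) n
count-+ P? zero    n = refl
count-+ P? (suc m) n with does (P? 0)
... | true  = cong suc (count-+ (P? ∘ suc) m n)
... | false = count-+ (P? ∘ suc) m n

length-filter-applyUpTo : (P? : Decidable P) (f : ℕ → ℕ) →
                          ∀ k → length (filter P? (applyUpTo f k)) ≡ count (P? ∘ f) k
length-filter-applyUpTo P? f zero = refl
length-filter-applyUpTo P? f (suc k) with does (P? (f 0))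
... | true  = cong suc (length-filter-applyUpTo P? (f ∘ suc) k)
... | false = length-filter-applyUpTo P? (f ∘ suc) k

count-periodic : (P? : Decidable P) {p : ℕ} → (∀ i → P (p + i) ⇔ P i) →
                 ∀ n r → count P? (n * p + r) ≡ n * count P? p + count P? r
count-periodic P? per zero    r = refl
count-periodic P? {p} per (suc n) r = begin
  count P? (p + n * p + r)                      ≡⟨ cong (count P?) (+-assoc p (n * p) r) ⟩
  count P? (p + (n * p + r))                    ≡⟨ count-+ P? p (n * p + r) ⟩
  count P? p + count (P? ∘ (p +_)) (n * p + r)  ≡⟨ cong (count P? p +_)
                                                       (count-cong (P? ∘ (p +_)) P? per (n * p + r)) ⟩
  count P? p + count P? (n * p + r)             ≡⟨ cong (count P? p +_) (count-periodic P? per n r) ⟩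
  count P? p + (n * count P? p + count P? r)    ≡⟨ +-assoc (count P? p) (n * count P? p) (count P? r) ⟨
  suc n * count P? p + count P? r               ∎
  where open ≡-Reasoning

+-/2-mono : ∀ x y r → x * 2 ≤ y → x + r / 2 ≤ (y + r) / 2
+-/2-mono x y r x*2≤y = begin
  x + r / 2           ≡⟨ cong (_+ r / 2) (m*n/n≡m x 2) ⟨
  x * 2 / 2 + r / 2   ≡⟨ +-distrib-/-∣ˡ r (divides x refl) ⟨
  (x * 2 + r) / 2     ≤⟨ /-monoˡ-≤ 2 (+-monoˡ-≤ r x*2≤y) ⟩
  (y + r) / 2         ∎
  where open ≤-Reasoning

periodic⇒count≤half : (P? : Decidable P) (p : ℕ) .{{_ : NonZero p}} →
                      (∀ i → P (p + i) ⇔ P i) → count P? p * 2 ≤ p →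
                      (∀ {r} → r < p → count P? r ≤ r / 2 + 1) →
                      ∀ k → count P? k ≤ k / 2 + 1
periodic⇒count≤half P? p per sparse initial k = begin
  count P? k                 ≡⟨ cong (count P?) k≡np+r ⟩
  count P? (n * p + r)       ≡⟨ count-periodic P? per n r ⟩
  n * c + count P? r         ≤⟨ +-monoʳ-≤ (n * c) (initial (m%n<n k p)) ⟩
  n * c + (r / 2 + 1)        ≡⟨ +-assoc (n * c) (r / 2) 1 ⟨
  n * c + r / 2 + 1          ≤⟨ +-monoˡ-≤ 1 (+-/2-mono (n * c) (n * p) r nc*2≤np) ⟩
  (n * p + r) / 2 + 1        ≡⟨ cong (λ m → m / 2 + 1) k≡np+r ⟨
  k / 2 + 1                  ∎
  where
  open ≤-Reasoning
  n r c : ℕ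
  n = k / p
  r = k % p
  c = count P? p
  k≡np+r : k ≡ n * p + r
  k≡np+r = trans (m≡m%n+[m/n]*n k p) (+-comm r (n * p))
  nc*2≤np : n * c * 2 ≤ n * p
  nc*2≤np = subst (_≤ n * p) (sym (*-assoc n c 2)) (*-monoʳ-≤ n sparse)

Sieved : Pred ℕ _
Sieved n = ¬ 3 ∣ n × ¬ 5 ∣ n × ¬ 7 ∣ n

sieved? : Decidable Sieved
sieved? n = ¬? (3 ∣? n) ×-dec ¬? (5 ∣? n) ×-dec ¬? (7 ∣? n)

prime⇒sieved : ∀ {n} → Prime n → 7 < n → Sieved n
prime⇒sieved {n} pr 7<n = ¬∣ 3 (m≤m+n 3 4) , ¬∣ 5 (m≤m+n 5 2) , ¬∣ 7 ≤-refl
  where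
  ¬∣ : ∀ d .{{_ : NonTrivial d}} → d ≤ 7 → ¬ d ∣ n
  ¬∣ d d≤7 d∣n = Prime.notComposite pr (composite (≤-<-trans d≤7 7<n) d∣n)

¬∣-+-multiple : ∀ {d m n} → d ∣ m → (¬ d ∣ m + n) ⇔ (¬ d ∣ n)
¬∣-+-multiple d∣m = mk⇔ (λ ∤m+n d∣n → ∤m+n (∣m∣n⇒∣m+n d∣m d∣n))
                        (λ ∤n d∣m+n → ∤n (∣m+n∣m⇒∣n d∣m+n d∣m))

sieved-+-multiple : ∀ {m n} → 105 ∣ m → Sieved (m + n) ⇔ Sieved n
sieved-+-multiple 105∣m = ¬∣-+-multiple (∣-trans (divides 35 refl) 105∣m)
                      ×-⇔ ¬∣-+-multiple (∣-trans (divides 21 refl) 105∣m)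
                      ×-⇔ ¬∣-+-multiple (∣-trans (divides 15 refl) 105∣m)

term : ℕ → ℕ → ℕ
term q i = 2 * q * suc i + 1

survivors : ℕ → ℕ → ℕ
survivors q = count (sieved? ∘ term q)

term-periodic : ∀ q i → term q (105 + i) ≡ (2 * q) * 105 + term q i
term-periodic = expand
  where
  expand : ∀ q i → 2 * q * suc (105 + i) + 1 ≡ (2 * q) * 105 + (2 * q * suc i + 1)
  expand = solve-∀

term-mod : ∀ q i → term q i ≡ (2 * (q / 105) * suc i) * 105 + term (q % 105) i
term-mod q i = trans (cong (λ x → term x i) (m≡m%n+[m/n]*n q 105)) (expand (q % 105) (q / 105) i)
  where
  expand : ∀ r d i → 2 * (r + d * 105) * suc i + 1 ≡ (2 * d * suc i) * 105 + (2 * r * suc i + 1)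
  expand = solve-∀

sieved-term-periodic : ∀ q i → Sieved (term q (105 + i)) ⇔ Sieved (term q i)
sieved-term-periodic q i = subst (λ x → Sieved x ⇔ Sieved (term q i)) (sym (term-periodic q i))
                             (sieved-+-multiple (n∣m*n (2 * q)))

sieved-term-mod : ∀ q i → Sieved (term q i) ⇔ Sieved (term (q % 105) i)
sieved-term-mod q i = subst (λ x → Sieved x ⇔ Sieved (term (q % 105) i)) (sym (term-mod q i))
                        (sieved-+-multiple (n∣m*n (2 * (q / 105) * suc i)))

sieved-mod : ∀ {q} → Sieved q → Sieved (q % 105)
sieved-mod {q} sq = Equivalence.to (sieved-+-multiple (n∣m*n (q / 105)))
                      (subst Sieved (trans (m≡m%n+[m/n]*n q 105) (+-comm (q % 105) _)) sq)

SparseSieve : ℕ → Set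
SparseSieve r = survivors r 105 * 2 ≤ 105 × (∀ {k} → k < 105 → survivors r k ≤ k / 2 + 1)

sparseSieve? : Decidable SparseSieve
sparseSieve? r = (survivors r 105 * 2 ≤? 105) ×-dec allUpTo? (λ k → survivors r k ≤? k / 2 + 1) 105

sieved⇒sparseSieve : ∀ {r} → r < 105 → Sieved r → SparseSieve r
sieved⇒sparseSieve = toWitness {a? = allUpTo? (λ r → sieved? r →-dec sparseSieve? r) 105} _

sparseSieve⇒survivors≤half : ∀ r → SparseSieve r → ∀ k → survivors r k ≤ k / 2 + 1
sparseSieve⇒survivors≤half r (sparse , initial) =
  periodic⇒count≤half (sieved? ∘ term r) 105 (sieved-term-periodic r) sparse initial

survivors≤half : ∀ {q} → Sieved q → ∀ k → survivors q k ≤ k / 2 + 1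
survivors≤half {q} sq k = begin
  survivors q k          ≡⟨ count-cong (sieved? ∘ term q) (sieved? ∘ term r) (sieved-term-mod q) k ⟩
  survivors r k          ≤⟨ sparseSieve⇒survivors≤half r
                               (sieved⇒sparseSieve (m%n<n q 105) (sieved-mod sq)) k ⟩
  k / 2 + 1              ∎
  where
  open ≤-Reasoning
  r : ℕ
  r = q % 105

7<term : ∀ {q} → 7 < q → ∀ i → 7 < term q i
7<term {q} 7<q i = begin-strict
  7              <⟨ 7<q ⟩
  q              ≤⟨ m≤n*m q 2 ⟩
  2 * q          ≤⟨ m≤m*n (2 * q) (suc i) ⟩
  2 * q * suc i  ≤⟨ m≤m+n (2 * q * suc i) 1 ⟩
  term q i       ∎
  where open ≤-Reasoning

primeCount≤survivors : ∀ {q} → 7 < q → ∀ k → primeCount q k ≤ survivors q k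
primeCount≤survivors {q} 7<q k = begin
  primeCount q k                ≡⟨ length-filter-applyUpTo prime? (term q) k ⟩
  count (prime? ∘ term q) k     ≤⟨ count-mono (prime? ∘ term q) (sieved? ∘ term q)
                                      (λ {i} pr → prime⇒sieved pr (7<term 7<q i)) k ⟩
  survivors q k                 ∎
  where open ≤-Reasoning

lemma5p3 : ((q k : ℕ) → Prime q → 7 < q → 1 ≤ k → primeCount q k ≤ k / 2 + 1)
           × (primeCount 11 4 ≡ 4 / 2 + 1)
lemma5p3 = bound , refl
  where
  bound : (q k : ℕ) → Prime q → 7 < q → 1 ≤ k → primeCount q k ≤ k / 2 + 1
  bound q k pr 7<q _ = ≤-trans (primeCount≤survivors 7<q k) (survivors≤half (prime⇒sieved pr 7<q) k)
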